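{- Let $m,n$ be nonzero integers. There is no positive integral $SL_2$-tiling $(u_{i,j})_{i,j\in\mathbb Z}$ such that $u_{i,j}=u_{i+m,j}$ for all $i,j$, and there is none such that $u_{i,j}=u_{i,j+n}$ for all $i,j$.
   Context: An $SL_2$-tiling is a family $(u_{i,j})_{i,j\in\mathbb Z}$ of real numbers such that $u_{i+1,j}u_{i,j+1}-u_{i,j}u_{i+1,j+1}=1$ for all $i,j$. It is positive integral if all $u_{i,j}$ are positive integers. -}

module Defs where

open import Data.Integer using (ℤ; _+_; _*_; _-_; _<_; 0ℤ; 1ℤ)
open import Relation.Binary.PropositionalEquality using (_≡_)
open import Data.Product using (_×_)

IsSL2Tiling : (ℤ → ℤ → ℤ) → Set
IsSL2Tiling u = ∀ i j →
  u (i + 1ℤ) j * u i (j + 1ℤ) - u i j * u (i + 1ℤ) (j + 1ℤ) ≡ 1ℤ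

IsPositiveIntegral : (ℤ → ℤ → ℤ) → Set
IsPositiveIntegral u = ∀ i j → 0ℤ < u i j

IsPositiveIntegralSL2Tiling : (ℤ → ℤ → ℤ) → Set
IsPositiveIntegralSL2Tiling u = IsSL2Tiling u × IsPositiveIntegral u

{-# OPTIONS --safe #-}
-- For a positive tiling, the unimodular relation on the 2×2 block at rows i, i+1 and
-- columns j, j+1 says u(i,j)/u(i,j+1) < u(i+1,j)/u(i+1,j+1). So the ratio of two
-- adjacent columns is strictly increasing down the rows, which no nonzero vertical
-- period can preserve. Transposing a tiling gives a tiling, which handles columns.
module Submission where

open import Defs
open import Data.Integer using (ℤ; _+_; 0ℤ)
open import Data.Product using (Σ; _×_)
open import Relation.Binary.PropositionalEquality using (_≡_)
open import Relation.Nullary using (¬_)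

open import Data.Nat using (zero; suc)
open import Data.Integer using (_*_; _-_; _<_; 1ℤ; -_; +0; +[1+_]; -[1+_]; positive; nonNegative)
open import Data.Integer.Properties
  using ( +-assoc; *-comm; *-commutativeSemigroup; +-0-abelianGroup
        ; *-monoʳ-<-pos; *-cancelʳ-<-nonNeg
        ; <⇒≤; <-irrefl; ≤-reflexive; suc[i]≤j⇒i<j; module ≤-Reasoning)
open import Algebra.Properties.CommutativeSemigroup *-commutativeSemigroup using (xy∙z≈xz∙y)
open import Algebra.Properties.AbelianGroup +-0-abelianGroup using (//-rightDividesˡ)
open import Data.Product using (_,_; proj₁; proj₂; map)
open import Function using (flip)
open import Relation.Binary.PropositionalEquality using (refl; sym; trans; cong; cong₂; subst)

i-j≡1⇒j<i : ∀ {i j} → i - j ≡ 1ℤ → j < i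
i-j≡1⇒j<i {i} {j} i-j≡1 =
  suc[i]≤j⇒i<j (≤-reflexive (trans (cong (_+ j) (sym i-j≡1)) (//-rightDividesˡ j i)))

-- Transitivity of a/b < c/d < e/f, cross-multiplied.
*-cross-<-trans : ∀ {a b c d e f} → 0ℤ < b → 0ℤ < d → 0ℤ < f →
  a * d < c * b → c * f < e * d → a * f < e * b
*-cross-<-trans {a} {b} {c} {d} {e} {f} b>0 d>0 f>0 ad<cb cf<ed =
  *-cancelʳ-<-nonNeg d {{nonNegative (<⇒≤ d>0)}} (begin-strict
    a * f * d  ≡⟨ xy∙z≈xz∙y a f d ⟩
    a * d * f  <⟨ *-monoʳ-<-pos f {{positive f>0}} ad<cb ⟩
    c * b * f  ≡⟨ xy∙z≈xz∙y c b f ⟩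
    c * f * b  <⟨ *-monoʳ-<-pos b {{positive b>0}} cf<ed ⟩
    e * d * b  ≡⟨ xy∙z≈xz∙y e d b ⟩
    e * b * d  ∎)
  where open ≤-Reasoning

HasRowPeriod : (ℤ → ℤ → ℤ) → ℤ → Set
HasRowPeriod u m = ∀ i j → u i j ≡ u (i + m) j

HasRowPeriod-neg : ∀ {u m} → HasRowPeriod u m → HasRowPeriod u (- m)
HasRowPeriod-neg {u} {m} period i j =
  sym (trans (period (i - m) j) (cong (λ i′ → u i′ j) (//-rightDividesˡ m i)))

module PositiveIntegralSL2Tiling {u : ℤ → ℤ → ℤ} (tiling : IsPositiveIntegralSL2Tiling u) where

  private
    unimodular = proj₁ tiling
    u>0 = proj₂ tiling

  RatioIncreases : ℤ → ℤ → ℤ → Set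
  RatioIncreases j i i′ = u i j * u i′ (j + 1ℤ) < u i′ j * u i (j + 1ℤ)

  ratioIncreases-step : ∀ j i → RatioIncreases j i (i + 1ℤ)
  ratioIncreases-step j i = i-j≡1⇒j<i (unimodular i j)

  ratioIncreases-trans : ∀ {j i i′ i″} →
    RatioIncreases j i i′ → RatioIncreases j i′ i″ → RatioIncreases j i i″
  ratioIncreases-trans {j} {i} {i′} {i″} =
    *-cross-<-trans {a = u i j} {c = u i′ j} {e = u i″ j}
      (u>0 i (j + 1ℤ)) (u>0 i′ (j + 1ℤ)) (u>0 i″ (j + 1ℤ))

  ratioIncreases : ∀ j i k → RatioIncreases j i (i + +[1+ k ])
  ratioIncreases j i zero    = ratioIncreases-step j i
  ratioIncreases j i (suc k) = subst (RatioIncreases j i) (+-assoc i 1ℤ +[1+ k ])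
    (ratioIncreases-trans (ratioIncreases-step j i) (ratioIncreases j (i + 1ℤ) k))

  ¬HasRowPeriod-pos : ∀ k → ¬ HasRowPeriod u +[1+ k ]
  ¬HasRowPeriod-pos k period =
    <-irrefl (cong₂ _*_ (period 0ℤ 0ℤ) (sym (period 0ℤ 1ℤ))) (ratioIncreases 0ℤ 0ℤ k)

  ¬HasRowPeriod : ∀ {m} → ¬ (m ≡ 0ℤ) → ¬ HasRowPeriod u m
  ¬HasRowPeriod {+0}       m≢0 _      = m≢0 refl
  ¬HasRowPeriod {+[1+ k ]} _   period = ¬HasRowPeriod-pos k period
  ¬HasRowPeriod { -[1+ k ]} _  period = ¬HasRowPeriod-pos k (HasRowPeriod-neg period)

IsSL2Tiling-flip : ∀ {u} → IsSL2Tiling u → IsSL2Tiling (flip u)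
IsSL2Tiling-flip {u} unimodular i j =
  trans (cong (_- u j i * u (j + 1ℤ) (i + 1ℤ)) (*-comm (u j (i + 1ℤ)) (u (j + 1ℤ) i)))
        (unimodular j i)

IsPositiveIntegralSL2Tiling-flip : ∀ {u} →
  IsPositiveIntegralSL2Tiling u → IsPositiveIntegralSL2Tiling (flip u)
IsPositiveIntegralSL2Tiling-flip {u} = map (IsSL2Tiling-flip {u}) flip

proposition5p3 : (m n : ℤ) → ¬ (m ≡ 0ℤ) → ¬ (n ≡ 0ℤ) →
    (¬ Σ (ℤ → ℤ → ℤ) (λ u → IsPositiveIntegralSL2Tiling u × (∀ i j → u i j ≡ u (i + m) j)))
    × (¬ Σ (ℤ → ℤ → ℤ) (λ u → IsPositiveIntegralSL2Tiling u × (∀ i j → u i j ≡ u i (j + n))))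
proposition5p3 m n m≢0 n≢0 =
  (λ (u , tiling , period) → PositiveIntegralSL2Tiling.¬HasRowPeriod tiling m≢0 period)
  , λ (u , tiling , period) →
      PositiveIntegralSL2Tiling.¬HasRowPeriod (IsPositiveIntegralSL2Tiling-flip tiling) n≢0 (flip period)
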